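{- Let $G$ be a graph that is a proper interval $k$-graph or a unit interval $k$-graph, and fix a representation of $G$ witnessing this; regard the interval classes of this representation as the partite sets of $G$. Then $V(G)$ can be labeled $v_1,v_2,\dots,v_n$ so that, whenever $i<j<k'$ and $v_iv_{k'}\in E(G)$, the vertex $v_j$ is adjacent to each vertex of $\{v_i,v_{k'}\}$ that lies in a different partite set than $v_j$.
   Context: All graphs are finite and simple. A graph $G$ is an interval $k$-graph if there is a one-to-one correspondence $v\mapsto I_v$ between $V(G)$ and a family of closed intervals of the real line, together with a partition of the family into at most $k$ classes, such that distinct vertices $u,v$ are adjacent if and only if $I_u\cap I_v\neq\emptyset$ and $I_u,I_v$ lie in different classes; such a family with its partition is a representation. $G$ is a proper interval $k$-graph if it has such a representation in which no interval properly contains another interval (of any class), and a unit interval $k$-graph if it has such a representation in which all intervals have the same length.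
   Formalization: The intervals of the representation have rational endpoints rather than being arbitrary closed intervals of the real line. -}

module Defs where

open import Data.Nat using (ℕ)
open import Data.Fin using (Fin; _<_)
open import Data.Rational using (ℚ; _≤_; _<_; _-_)
open import Data.Product using (_×_; Σ; ∃)
open import Data.Sum using (_⊎_)
open import Relation.Nullary using (¬_)
open import Relation.Binary.PropositionalEquality using (_≡_; _≢_)
open import Function.Bundles using (_⇔_; _↔_; Inverse)

record Graph (n : ℕ) : Set₁ where
  field
    Adj     : Fin n → Fin n → Set
    sym     : ∀ {u v} → Adj u v → Adj v u
    irrefl  : ∀ {u} → ¬ Adj u u
open Graph public

record Rep {n : ℕ} (k : ℕ) (G : Graph n) : Set₁ where
  field
    left  : Fin n → ℚ
    right : Fin n → ℚ
    valid : ∀ v → left v ≤ right v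
    cls   : Fin n → Fin k
  Meets : Fin n → Fin n → Set
  Meets u v = (left u ≤ right v) × (left v ≤ right u)
  field
    adj-iff : ∀ u v → u ≢ v → Adj G u v ⇔ (Meets u v × cls u ≢ cls v)
open Rep public

ProperlyContains : ∀ {n k} {G : Graph n} → Rep k G → Fin n → Fin n → Set
ProperlyContains R u v =
  (left R u ≤ left R v) × (right R v ≤ right R u) ×
  ((left R u Data.Rational.< left R v) ⊎ (right R v Data.Rational.< right R u))

IsProper : ∀ {n k} {G : Graph n} → Rep k G → Set
IsProper {n} R = ∀ (u v : Fin n) → ¬ ProperlyContains R u v

IsUnit : ∀ {n k} {G : Graph n} → Rep k G → Set
IsUnit {n} R = Σ ℚ λ d → ∀ (v : Fin n) → right R v - left R v ≡ d

-- The desired vertex ordering: σ i is the vertex v_(i+1).  Whenever i < j < k'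
-- and v_i v_k' is an edge, v_j is adjacent to each of v_i, v_k' lying in a
-- different class (partite set) than v_j.
GoodOrdering : ∀ {n k} (G : Graph n) → Rep k G → (Fin n → Fin n) → Set
GoodOrdering {n} G R σ =
  ∀ (i j k' : Fin n) → i Data.Fin.< j → j Data.Fin.< k' → Adj G (σ i) (σ k') →
    (cls R (σ j) ≢ cls R (σ i) → Adj G (σ j) (σ i)) ×
    (cls R (σ j) ≢ cls R (σ k') → Adj G (σ j) (σ k'))

{-# OPTIONS --safe #-}
module Submission where

-- Order the vertices by left endpoint. In a proper representation the right
-- endpoints then come in the same order, so for u ≺ w ≺ x with I_u meeting I_x we
-- get l_u ≤ l_w ≤ l_x ≤ r_u ≤ r_w ≤ r_x, and I_w meets both I_u and I_x; across
-- classes, meeting is adjacency. Equal lengths rule out proper containment, so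
-- unit representations are proper.

open import Defs
open import Data.Nat using (ℕ; zero; suc; s≤s)
open import Data.Fin using (Fin; zero; suc)
import Data.Fin as Fin
open import Data.Fin.Properties using (<⇒≢)
import Data.Nat.Properties as ℕ
open import Data.Fin.Permutation using (Permutation′; _⟨$⟩ʳ_; _∘ₚ_; lift₀; transpose)
import Data.Fin.Permutation as Permutation
open import Data.Rational using (_≤_; _<_; _-_)
open import Data.Rational.Properties
  using (≤-trans; <⇒≤; ≰⇒>; <-irrefl; _≤?_; ≤-totalPreorder;
         +-mono-≤-<; +-mono-<-≤; neg-antimono-<; neg-antimono-≤)
open import Data.Product using (Σ; _×_; _,_; proj₁; proj₂)
open import Data.Sum using (_⊎_; inj₁; inj₂; [_,_])
open import Data.Empty using (⊥-elim)
open import Function using (id; _∘_; Injection; _↔_; Inverse; Equivalence)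
open import Function.Properties.Inverse using (↔⇒↣)
open import Relation.Binary using (TotalPreorder; _Preserves_⟶_)
open import Relation.Nullary using (yes; no)
open import Relation.Binary.PropositionalEquality using (_≢_)
import Relation.Binary.PropositionalEquality as ≡

module _ {c ℓ₁ ℓ₂} (O : TotalPreorder c ℓ₁ ℓ₂) where
  open TotalPreorder O using (Carrier; _≲_; total) renaming (refl to ≲-refl; trans to ≲-trans)

  argmin : ∀ {n} (f : Fin (suc n) → Carrier) → Σ (Fin (suc n)) λ m → ∀ i → f m ≲ f i
  argmin {zero}  f = zero , λ { zero → ≲-refl }
  argmin {suc n} f with argmin (f ∘ suc)
  ... | m , f[m]≲ with total (f zero) (f (suc m))
  ... | inj₁ f₀≲f[m] = zero , λ { zero → ≲-refl ; (suc i) → ≲-trans f₀≲f[m] (f[m]≲ i) }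
  ... | inj₂ f[m]≲f₀ = suc m , λ { zero → f[m]≲f₀ ; (suc i) → f[m]≲ i }

  sorting-permutation : ∀ {n} (f : Fin n → Carrier) →
    Σ (Permutation′ n) λ σ → (f ∘ (σ ⟨$⟩ʳ_)) Preserves Fin._≤_ ⟶ _≲_
  sorting-permutation {zero}  f = Permutation.id , λ { {()} }
  sorting-permutation {suc n} f with argmin f
  ... | m , f[m]≲ with sorting-permutation (f ∘ (transpose zero m ⟨$⟩ʳ_) ∘ suc)
  ... | τ , τ-sorted = lift₀ τ ∘ₚ transpose zero m , sorted
    where
    sorted : (f ∘ ((lift₀ τ ∘ₚ transpose zero m) ⟨$⟩ʳ_)) Preserves Fin._≤_ ⟶ _≲_
    sorted {zero}            _       = f[m]≲ _
    sorted {suc i} {suc j} (s≤s p) = τ-sorted p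

module _ {n k} {G : Graph n} (R : Rep k G) where

  isUnit⇒isProper : IsUnit R → IsProper R
  isUnit⇒isProper (d , length≡d) u v (lu≤lv , rv≤ru , strict) =
    <-irrefl (≡.trans (length≡d v) (≡.sym (length≡d u))) (shorter strict)
    where
    shorter : left R u < left R v ⊎ right R v < right R u →
              right R v - left R v < right R u - left R u
    shorter (inj₁ lu<lv) = +-mono-≤-< rv≤ru (neg-antimono-< lu<lv)
    shorter (inj₂ rv<ru) = +-mono-<-≤ rv<ru (neg-antimono-≤ lu≤lv)

  isProper⇒right-monotone : IsProper R → ∀ {u v} → left R u ≤ left R v → right R u ≤ right R v
  isProper⇒right-monotone proper {u} {v} lu≤lv with right R u ≤? right R v
  ... | yes ru≤rv = ru≤rv
  ... | no  ru≰rv = ⊥-elim (proper u v (lu≤lv , <⇒≤ (≰⇒> ru≰rv) , inj₂ (≰⇒> ru≰rv)))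

  isProper⇒meets-between : IsProper R → ∀ {u w x} →
    left R u ≤ left R w → left R w ≤ left R x → Meets R u x →
    Meets R w u × Meets R w x
  isProper⇒meets-between proper {u} {w} {x} lu≤lw lw≤lx (lu≤rx , lx≤ru) =
    (≤-trans lw≤lx lx≤ru , ≤-trans lu≤lw (valid R w)) ,
    (≤-trans (valid R w) rw≤rx , ≤-trans lx≤ru ru≤rw)
    where
    ru≤rw : right R u ≤ right R w
    ru≤rw = isProper⇒right-monotone proper lu≤lw
    rw≤rx : right R w ≤ right R x
    rw≤rx = isProper⇒right-monotone proper lw≤lx

  left-sorted⇒goodOrdering : IsProper R → (σ : Permutation′ n) →
    (left R ∘ (σ ⟨$⟩ʳ_)) Preserves Fin._≤_ ⟶ _≤_ → GoodOrdering G R (σ ⟨$⟩ʳ_)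
  left-sorted⇒goodOrdering proper σ sorted i j k i<j j<k σi~σk =
    adjacent (distinct i<j ∘ ≡.sym) (proj₁ between) , adjacent (distinct j<k) (proj₂ between)
    where
    distinct : ∀ {a b} → a Fin.< b → σ ⟨$⟩ʳ a ≢ σ ⟨$⟩ʳ b
    distinct a<b = <⇒≢ a<b ∘ Injection.injective (↔⇒↣ σ)

    adjacent : ∀ {u v} → u ≢ v → Meets R u v → cls R u ≢ cls R v → Adj G u v
    adjacent u≢v meets cls≢ = Equivalence.from (adj-iff R _ _ u≢v) (meets , cls≢)

    between : Meets R (σ ⟨$⟩ʳ j) (σ ⟨$⟩ʳ i) × Meets R (σ ⟨$⟩ʳ j) (σ ⟨$⟩ʳ k)
    between = isProper⇒meets-between proper (sorted (ℕ.<⇒≤ i<j)) (sorted (ℕ.<⇒≤ j<k))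
      (proj₁ (Equivalence.to (adj-iff R _ _ (distinct (ℕ.<-trans i<j j<k))) σi~σk))

theorem3p1 : ∀ {n : ℕ} (k : ℕ) (G : Graph n) (R : Rep k G) →
    IsProper R ⊎ IsUnit R →
    Σ (Fin n ↔ Fin n) λ σ → GoodOrdering G R (Inverse.to σ)
theorem3p1 k G R proper-or-unit =
  let σ , left-sorted = sorting-permutation ≤-totalPreorder (left R)
  in  σ , left-sorted⇒goodOrdering R proper σ left-sorted
  where
  proper : IsProper R
  proper = [ id , isUnit⇒isProper R ] proper-or-unit
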